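{- Let $S$ be a nonempty subset of $\mathbb{Z}$ and let $\mathcal{T}\subseteq\mathbb{N}$. Then for integers $0\le\ell\le k<|S|$, the generalized binomial coefficient $$\binom{k}{\ell}_{S,\mathcal{T}}:=\frac{k!_{S,\mathcal{T}}}{\ell!_{S,\mathcal{T}}\,(k-\ell)!_{S,\mathcal{T}}}$$ is a positive integer.
   Context: For integers $b\ge0$ and $a\in\mathbb{Z}$ let $\operatorname{ord}_b(a):=\sup\{k\in\mathbb{N}: a\mathbb{Z}\subseteq b^k\mathbb{Z}\}$ (convention $0^0=1$); for $b\ge2$ this is the largest $k$ with $b^k\mid a$, $\operatorname{ord}_b(0)=+\infty$; $\operatorname{ord}_1\equiv+\infty$; $\operatorname{ord}_0(a)=0$ for $a\ne0$, $\operatorname{ord}_0(0)=+\infty$. For nonempty $S\subseteq\mathbb{Z}$, a $b$-ordering of $S$ is an infinite sequence $(a_i)_{i\ge0}$ in $S$ such that for every $i\ge1$, $\sum_{j<i}\operatorname{ord}_b(a_i-a_j)=\min_{a'\in S}\sum_{j<i}\operatorname{ord}_b(a'-a_j)$. The quantity $\alpha_k(S,b):=\sum_{j<k}\operatorname{ord}_b(a_k-a_j)$ (with $\alpha_0=0$) does not depend on the choice of $b$-ordering. For $\mathcal{T}\subseteq\mathbb{N}$, $k!_{S,\mathcal{T}}:=\prod_{b\in\mathcal{T}}b^{\alpha_k(S,b)}$, with conventions $b^{+\infty}=0$ for $b\ge2$ and $b=0$, $1^{+\infty}=1$, and $b^0=1$ for all $b$. -}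

module Defs where

open import Data.Nat using (ℕ; zero; suc; _+_; _*_; _^_; _≡ᵇ_) renaming (_≤_ to _≤ℕ_)
open import Data.Nat.Divisibility using (_∣_)
open import Data.Integer using (ℤ; ∣_∣; _-_)
open import Data.List using (List; []; _∷_; map; upTo)
open import Data.Nat.ListAction using (product)
open import Data.List.Membership.Propositional using (_∉_)
open import Data.List.Relation.Unary.Unique.Propositional using (Unique)
open import Data.Fin using (Fin)
open import Data.Bool using (if_then_else_)
open import Data.Product using (Σ; _×_; proj₁; proj₂; _,_)
open import Function.Definitions using (Injective)
open import Relation.Binary.PropositionalEquality using (_≡_)
open import Relation.Nullary using (¬_)

data ℕ∞ : Set where
  fin : ℕ → ℕ∞
  ∞   : ℕ∞

_⊕_ : ℕ∞ → ℕ∞ → ℕ∞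
fin m ⊕ fin n = fin (m + n)
fin _ ⊕ ∞     = ∞
∞     ⊕ _     = ∞

data _≤∞_ : ℕ∞ → ℕ∞ → Set where
  fin≤fin : ∀ {m n} → m ≤ℕ n → fin m ≤∞ fin n
  _≤∞∞    : ∀ x → x ≤∞ ∞

-- b ^ v with conventions b^{+∞} = 0 for b ≠ 1, 1^{+∞} = 1, b^0 = 1 (0^0 = 1 in stdlib)
pow∞ : ℕ → ℕ∞ → ℕ
pow∞ b (fin n) = b ^ n
pow∞ b ∞       = if b ≡ᵇ 1 then 1 else 0

-- IsOrd b a v  :  ord_b(a) = v, where ord_b(a) = sup { k : b^k ∣ a }
-- (the set {k : b^k ∣ a} is downward closed, so the sup is either the largest
--  such k or +∞ when all k qualify).  Uses 0^0 = 1.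
IsOrd : ℕ → ℤ → ℕ∞ → Set
IsOrd b a (fin k) = (b ^ k ∣ ∣ a ∣) × ¬ (b ^ suc k ∣ ∣ a ∣)
IsOrd b a ∞       = ∀ k → b ^ k ∣ ∣ a ∣

data OrdSum (b : ℕ) (x : ℤ) : List ℤ → ℕ∞ → Set where
  nil  : OrdSum b x [] (fin 0)
  cons : ∀ {y ys u w} → IsOrd b (x - y) u → OrdSum b x ys w →
         OrdSum b x (y ∷ ys) (u ⊕ w)

prefix : (ℕ → ℤ) → ℕ → List ℤ
prefix a i = map a (upTo i)

IsBOrdering : (ℤ → Set) → ℕ → (ℕ → ℤ) → Set
IsBOrdering S b a =
  ((i : ℕ) → S (a i)) ×
  ((i : ℕ) → 1 ≤ℕ i → ∀ v → OrdSum b (a i) (prefix a i) v →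
     ∀ a' → S a' → ∀ w → OrdSum b a' (prefix a i) w → v ≤∞ w)

IsAlpha : (ℤ → Set) → ℕ → ℕ → ℕ∞ → Set
IsAlpha S b k v = Σ (ℕ → ℤ) λ a → IsBOrdering S b a × OrdSum b (a k) (prefix a k) v

-- k!_{S,𝒯} = n :  n = ∏_{b ∈ 𝒯} b^{α_k(S,b)}, the (possibly infinite) product
-- being given by a finite list of distinct factors b ∈ 𝒯 (with their α-values)
-- outside of which every factor equals 1.
IsFactorial : (ℤ → Set) → (ℕ → Set) → ℕ → ℕ → Set
IsFactorial S T k n =
  Σ (List (ℕ × ℕ∞)) λ L →
    Unique (map proj₁ L) ×
    ((p : ℕ × ℕ∞) → p ∈L L → T (proj₁ p) × IsAlpha S (proj₁ p) k (proj₂ p)) ×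
    (n ≡ product (map (λ p → pow∞ (proj₁ p) (proj₂ p)) L)) ×
    (∀ b → T b → b ∉ map proj₁ L → ∀ v → IsAlpha S b k v → pow∞ b v ≡ 1)
  where
  open import Data.List.Membership.Propositional renaming (_∈_ to _∈L_)

-- k < |S| : S contains at least k+1 distinct elements
CardGt : (ℤ → Set) → ℕ → Set
CardGt S k = Σ (Fin (suc k) → ℤ) λ f → Injective _≡_ _≡_ f × (∀ i → S (f i))

{-# OPTIONS --safe #-}
-- Fix b and write α_n for α_n(S, b). Superadditivity, α_ℓ + α_m ≤ α_k for ℓ + m = k (with the
-- three values computed from arbitrary b-orderings), makes b^α_ℓ · b^α_m divide b^α_k; for
-- b ≠ 1 and k < |S| the α_n are finite, so all factors are positive. Multiplying over b ∈ 𝒯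
-- gives the theorem.
--
-- For superadditivity let (a_i) be a b-ordering with α_k = N < ∞ and truncate valuations at
-- H = N + 1: w(y, X) = Σ_{x ∈ X} min(ord_b(y − x), H) counts, for each level 1 ≤ s ≤ H, the
-- elements of X congruent to y modulo b^s, and b-orderings still minimise w below H. The key
-- claim is that every list X of k integers has w(a_i, X) ≤ N for some i ≤ k. Start from a_k at
-- level 0; at each level, pigeonhole yields an earlier term in the current class whose class one
-- level deeper holds no more elements of X than of the terms preceding it, and minimality of the
-- ordering controls the weight of the remaining levels. Taking for X the first ℓ terms of one
-- b-ordering followed by the first m terms of another, minimality of those two orderings gives
-- α_ℓ + α_m ≤ w(a_i, X) ≤ N.
module Submission where

open import Defs
open import Data.Nat using (ℕ; _*_; _∸_; _≤_; _<_)
open import Data.Integer using (ℤ)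
open import Data.Product using (Σ; _×_)
open import Relation.Binary.PropositionalEquality using (_≡_)

import Algebra.Properties.CommutativeSemigroup as CommSemigroupProperties
open import Data.Bool using (Bool; true; false; if_then_else_)
open import Data.Fin using (Fin; toℕ)
import Data.Fin.Properties as Fin
open import Data.Integer as Int using (∣_∣; _-_)
import Data.Integer.Properties as ℤ
import Data.Integer.Divisibility.Signed as Signed
open import Data.List using (List; []; _∷_; _++_; [_]; map; upTo; length; lookup)
open import Data.List.Properties using (map-++; length-map; upTo-∷ʳ; length-upTo; length-++; map-cong-local)
open import Data.List.Membership.Propositional using (_∈_; _∉_)
open import Data.List.Membership.Propositional.Properties using (∈-map⁺)
import Data.List.Membership.DecPropositional as DecMembership
import Data.List.Relation.Unary.All as All
import Data.List.Relation.Unary.All.Properties as All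
open import Data.List.Relation.Unary.Any using (here; there; index; tail)
open import Data.List.Relation.Unary.Any.Properties using (lookup-index)
open import Data.List.Relation.Unary.Unique.Propositional using (Unique; _∷_)
open import Data.Nat
  using (zero; suc; _+_; _^_; _⊓_; z≤n; s≤s; z<s; _≟_; _≤?_; NonZero; >-nonZero; >-nonZero⁻¹)
open import Data.Nat.Properties
open import Data.Nat.Divisibility
  using ( _∣_; divides; _∣?_; ∣-trans; ∣-reflexive; _∣0; 1∣_; 0∣⇒≡0; ∣1⇒≡1; >⇒∤; m∣m*n
        ; *-pres-∣; m*n∣⇒m∣)
open import Data.Nat.ListAction using (product)
open import Data.Nat.ListAction.Properties using (product≢0)
open import Data.Product using (_,_; proj₁; proj₂; ∃-syntax)
open import Data.Sum using (inj₁; inj₂)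
open import Function using (_∘_)
open import Function.Bundles using (mk⇔)
open import Function.Definitions using (Injective)
open import Relation.Nullary using (¬_; Dec; yes; no; does; contradiction; ¬?)
open import Relation.Nullary.Decidable using (map′; dec-true; dec-false; decidable-stable; does-⇔)
open import Relation.Unary using (Decidable)
open import Relation.Binary.PropositionalEquality
  using (_≢_; refl; sym; trans; cong; cong₂; subst; subst₂; module ≡-Reasoning)

open CommSemigroupProperties +-commutativeSemigroup using () renaming (interchange to +-interchange)
open CommSemigroupProperties *-commutativeSemigroup
  using () renaming (interchange to *-interchange; x∙yz≈y∙xz to *-left-comm)
open DecMembership ℤ._≟_ using () renaming (_∈?_ to _∈ℤ?_)
open DecMembership _≟_ using () renaming (_∈?_ to _∈ℕ?_)

n<[2+c]^n : ∀ c n → n < suc (suc c) ^ n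
n<[2+c]^n c zero = z<s
n<[2+c]^n c (suc n) = +-mono-≤ {1} {x} (≤-trans z<s ih) (≤-trans ih (m≤m+n x (c * x)))
  where
  x = suc (suc c) ^ n
  ih = n<[2+c]^n c n

^-monoʳ-∣ : ∀ b {m n} → m ≤ n → b ^ m ∣ b ^ n
^-monoʳ-∣ b {m} {n} m≤n =
  subst (b ^ m ∣_) (trans (sym (^-distribˡ-+-* b m (n ∸ m))) (cong (b ^_) (m+[n∸m]≡n m≤n))) (m∣m*n _)

∣⇒pos-quotient : ∀ {d n} → 0 < n → d ∣ n → Σ ℕ λ q → 0 < q × n ≡ q * d
∣⇒pos-quotient {d} 0<n (divides q n≡qd) =
  q , n≢0⇒n>0 (λ q≡0 → <-irrefl (sym (trans n≡qd (cong (_* d) q≡0))) 0<n) , n≡qd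

crossing : ∀ {P : ℕ → Set} → Decidable P → P 0 → ∀ m → ¬ P m → ∃[ k ] P k × ¬ P (suc k)
crossing P? P0 zero ¬P0 = contradiction P0 ¬P0
crossing P? P0 (suc m) ¬Pm+1 with P? m
... | yes Pm = m , Pm , ¬Pm+1
... | no ¬Pm = crossing P? P0 m ¬Pm

b^k∣1+n⇒b≡1 : ∀ b n → (∀ k → b ^ k ∣ suc n) → b ≡ 1
b^k∣1+n⇒b≡1 zero n all = contradiction (0∣⇒≡0 (all 1)) 1+n≢0
b^k∣1+n⇒b≡1 (suc zero) n all = refl
b^k∣1+n⇒b≡1 (suc (suc c)) n all = contradiction (all (suc n)) (>⇒∤ (n<[2+c]^n c (suc n)))

≤∞-trans : ∀ {u v w} → u ≤∞ v → v ≤∞ w → u ≤∞ w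
≤∞-trans (fin≤fin p) (fin≤fin q) = fin≤fin (≤-trans p q)
≤∞-trans _ (_ ≤∞∞) = _ ≤∞∞

≤∞-fin : ∀ {v n} → v ≤∞ fin n → ∃[ m ] v ≡ fin m × m ≤ n
≤∞-fin (fin≤fin m≤n) = _ , refl , m≤n

truncate : ℕ → ℕ∞ → ℕ
truncate H (fin k) = k ⊓ H
truncate H ∞ = H

truncate<⇒≡fin : ∀ {H} u → truncate H u < H → u ≡ fin (truncate H u)
truncate<⇒≡fin {H} ∞ H<H = contradiction H<H (<-irrefl refl)
truncate<⇒≡fin {H} (fin k) k⊓H<H with ≤-total k H
... | inj₁ k≤H = cong fin (sym (m≤n⇒m⊓n≡m k≤H))
... | inj₂ H≤k = contradiction (subst (_< H) (m≥n⇒m⊓n≡n H≤k) k⊓H<H) (<-irrefl refl)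

pow∞-1 : ∀ v → pow∞ 1 v ≡ 1
pow∞-1 (fin n) = ^-zeroˡ n
pow∞-1 ∞ = refl

∣pow∞-∞ : ∀ b u v → pow∞ b u * pow∞ b v ∣ pow∞ b ∞
∣pow∞-∞ zero u v = _ ∣0
∣pow∞-∞ (suc zero) u v = ∣-reflexive (cong₂ _*_ (pow∞-1 u) (pow∞-1 v))
∣pow∞-∞ (suc (suc _)) u v = _ ∣0

pow∞-⊕-∣ : ∀ b {u v w} → (u ⊕ v) ≤∞ w → pow∞ b u * pow∞ b v ∣ pow∞ b w
pow∞-⊕-∣ b {fin c₁} {fin c₂} (fin≤fin c₁+c₂≤n) =
  subst (_∣ _) (^-distribˡ-+-* b c₁ c₂) (^-monoʳ-∣ b c₁+c₂≤n)
pow∞-⊕-∣ b {u} {v} {∞} _ = ∣pow∞-∞ b u v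

sumFrom : (ℕ → ℕ) → ℕ → ℕ → ℕ
sumFrom f lo zero = 0
sumFrom f lo (suc c) = f lo + sumFrom f (suc lo) c

sumFrom-+ : ∀ f lo c₁ c₂ → sumFrom f lo (c₁ + c₂) ≡ sumFrom f lo c₁ + sumFrom f (lo + c₁) c₂
sumFrom-+ f lo zero c₂ = cong (λ l → sumFrom f l c₂) (sym (+-identityʳ lo))
sumFrom-+ f lo (suc c₁) c₂ = begin
  f lo + sumFrom f (suc lo) (c₁ + c₂)
    ≡⟨ cong (f lo +_) (sumFrom-+ f (suc lo) c₁ c₂) ⟩
  f lo + (sumFrom f (suc lo) c₁ + sumFrom f (suc lo + c₁) c₂)
    ≡⟨ cong (λ l → f lo + (sumFrom f (suc lo) c₁ + sumFrom f l c₂)) (sym (+-suc lo c₁)) ⟩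
  f lo + (sumFrom f (suc lo) c₁ + sumFrom f (lo + suc c₁) c₂)
    ≡⟨ +-assoc (f lo) _ _ ⟨
  f lo + sumFrom f (suc lo) c₁ + sumFrom f (lo + suc c₁) c₂ ∎
  where open ≡-Reasoning

sumFrom-cong : ∀ {f g} lo c → (∀ {s} → lo ≤ s → s < lo + c → f s ≡ g s) →
               sumFrom f lo c ≡ sumFrom g lo c
sumFrom-cong lo zero _ = refl
sumFrom-cong {f} {g} lo (suc c) f≗g =
  cong₂ _+_ (f≗g ≤-refl (m<m+n lo z<s)) (sumFrom-cong (suc lo) c f≗g′)
  where
  f≗g′ : ∀ {s} → suc lo ≤ s → s < suc lo + c → f s ≡ g s
  f≗g′ {s} lo<s s<end = f≗g (<⇒≤ lo<s) (subst (s <_) (sym (+-suc lo c)) s<end)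

sumFrom-const : ∀ k lo c → sumFrom (λ _ → k) lo c ≡ c * k
sumFrom-const k lo zero = refl
sumFrom-const k lo (suc c) = cong (k +_) (sumFrom-const k (suc lo) c)

sumFrom-constant : ∀ {f} k lo c → (∀ {s} → lo ≤ s → s < lo + c → f s ≡ k) → sumFrom f lo c ≡ c * k
sumFrom-constant k lo c f≡k = trans (sumFrom-cong lo c f≡k) (sumFrom-const k lo c)

sumFrom-mono : ∀ {f g} → (∀ s → f s ≤ g s) → ∀ lo c → sumFrom f lo c ≤ sumFrom g lo c
sumFrom-mono f≤g lo zero = z≤n
sumFrom-mono f≤g lo (suc c) = +-mono-≤ (f≤g lo) (sumFrom-mono f≤g (suc lo) c)

sumFrom-distrib : ∀ f g lo c → sumFrom (λ s → f s + g s) lo c ≡ sumFrom f lo c + sumFrom g lo c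
sumFrom-distrib f g lo zero = refl
sumFrom-distrib f g lo (suc c) =
  trans (cong (f lo + g lo +_) (sumFrom-distrib f g (suc lo) c)) (+-interchange (f lo) (g lo) _ _)

indicator : Bool → ℕ
indicator true = 1
indicator false = 0

module _ {A : Set} where

  countᵇ : (A → Bool) → List A → ℕ
  countᵇ p [] = 0
  countᵇ p (x ∷ xs) = indicator (p x) + countᵇ p xs

  countᵇ-++ : ∀ p xs ys → countᵇ p (xs ++ ys) ≡ countᵇ p xs + countᵇ p ys
  countᵇ-++ p [] ys = refl
  countᵇ-++ p (x ∷ xs) ys =
    trans (cong (indicator (p x) +_) (countᵇ-++ p xs ys)) (sym (+-assoc (indicator (p x)) _ _))

  countᵇ-cong : ∀ {p q} → (∀ x → p x ≡ q x) → ∀ xs → countᵇ p xs ≡ countᵇ q xs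
  countᵇ-cong p≗q [] = refl
  countᵇ-cong p≗q (x ∷ xs) = cong₂ _+_ (cong indicator (p≗q x)) (countᵇ-cong p≗q xs)

  countᵇ-split : ∀ {p q r} → (∀ x → indicator (p x) ≡ indicator (q x) + indicator (r x)) →
                 ∀ xs → countᵇ p xs ≡ countᵇ q xs + countᵇ r xs
  countᵇ-split split [] = refl
  countᵇ-split {p} {q} {r} split (x ∷ xs) =
    trans (cong₂ _+_ (split x) (countᵇ-split {p} {q} {r} split xs))
          (+-interchange (indicator (q x)) (indicator (r x)) (countᵇ q xs) (countᵇ r xs))

  countᵇ-all : ∀ {p} → (∀ x → p x ≡ true) → ∀ xs → countᵇ p xs ≡ length xs
  countᵇ-all all [] = refl
  countᵇ-all all (x ∷ xs) = cong₂ _+_ (cong indicator (all x)) (countᵇ-all all xs)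

prefix-suc : ∀ {A : Set} (a : ℕ → A) n → map a (upTo (suc n)) ≡ map a (upTo n) ++ [ a n ]
prefix-suc a n = trans (cong (map a) (sym (upTo-∷ʳ n))) (map-++ a (upTo n) [ n ])

length-prefix : ∀ a n → length (prefix a n) ≡ n
length-prefix a n = trans (length-map a (upTo n)) (length-upTo n)

length-prefix-++ : ∀ a₁ a₂ ℓ m → length (prefix a₁ ℓ ++ prefix a₂ m) ≡ ℓ + m
length-prefix-++ a₁ a₂ ℓ m =
  trans (length-++ (prefix a₁ ℓ)) (cong₂ _+_ (length-prefix a₁ ℓ) (length-prefix a₂ m))

countᵇ-prefix-suc : ∀ p a n → countᵇ p (prefix a (suc n)) ≡ countᵇ p (prefix a n) + indicator (p (a n))
countᵇ-prefix-suc p a n = begin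
  countᵇ p (prefix a (suc n))                           ≡⟨ cong (countᵇ p) (prefix-suc a n) ⟩
  countᵇ p (prefix a n ++ [ a n ])                      ≡⟨ countᵇ-++ p (prefix a n) [ a n ] ⟩
  countᵇ p (prefix a n) + (indicator (p (a n)) + 0)     ≡⟨ cong (countᵇ p (prefix a n) +_) (+-identityʳ _) ⟩
  countᵇ p (prefix a n) + indicator (p (a n))           ∎
  where open ≡-Reasoning

countᵇ-prefix-mono : ∀ p a {i j} → i ≤ j → countᵇ p (prefix a i) ≤ countᵇ p (prefix a j)
countᵇ-prefix-mono p a {j = zero} z≤n = ≤-refl
countᵇ-prefix-mono p a {i} {suc j} i≤1+j with m≤n⇒m<n∨m≡n i≤1+j
... | inj₂ refl = ≤-refl
... | inj₁ i<1+j = begin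
  countᵇ p (prefix a i)                         ≤⟨ countᵇ-prefix-mono p a (≤-pred i<1+j) ⟩
  countᵇ p (prefix a j)                         ≤⟨ m≤m+n _ _ ⟩
  countᵇ p (prefix a j) + indicator (p (a j))   ≡⟨ countᵇ-prefix-suc p a j ⟨
  countᵇ p (prefix a (suc j))                   ∎
  where open ≤-Reasoning

-- Valuations

ord-exists-ℕ : ∀ b n → Σ ℕ∞ (IsOrd b (Int.+ n))
ord-exists-ℕ b zero = ∞ , λ k → _ ∣0
ord-exists-ℕ zero (suc n) = fin 0 , 1∣ _ , λ 0∣1+n → 1+n≢0 (0∣⇒≡0 0∣1+n)
ord-exists-ℕ (suc zero) (suc n) = ∞ , λ k → subst (_∣ suc n) (sym (^-zeroˡ k)) (1∣ _)
ord-exists-ℕ (suc (suc c)) (suc n)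
  with k , bᵏ∣ , bᵏ⁺¹∤ ← crossing (λ k → suc (suc c) ^ k ∣? suc n) (1∣ _)
                                  (suc n) (>⇒∤ (n<[2+c]^n c (suc n)))
  = fin k , bᵏ∣ , bᵏ⁺¹∤

IsOrd-∣∣ : ∀ {b z} v → IsOrd b (Int.+ ∣ z ∣) v → IsOrd b z v
IsOrd-∣∣ (fin k) o = o
IsOrd-∣∣ ∞ o = o

ord-exists : ∀ b z → Σ ℕ∞ (IsOrd b z)
ord-exists b z = let v , o = ord-exists-ℕ b ∣ z ∣ in v , IsOrd-∣∣ v o

ordSum-exists : ∀ b y xs → Σ ℕ∞ (OrdSum b y xs)
ordSum-exists b y [] = fin 0 , nil
ordSum-exists b y (x ∷ xs) =
  let u , o = ord-exists b (y - x)
      w , s = ordSum-exists b y xs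
  in u ⊕ w , cons o s

ord≡∞⇒∣∣≡0 : ∀ {b} z → b ≢ 1 → IsOrd b z ∞ → ∣ z ∣ ≡ 0
ord≡∞⇒∣∣≡0 {b} z b≢1 all with ∣ z ∣
... | zero = refl
... | suc n = contradiction (b^k∣1+n⇒b≡1 b n all) b≢1

ordSum-finite : ∀ {b y xs v} → b ≢ 1 → y ∉ xs → OrdSum b y xs v → ∃[ c ] v ≡ fin c
ordSum-finite b≢1 y∉xs nil = 0 , refl
ordSum-finite b≢1 y∉x∷xs (cons {u = fin k} _ s)
  with c , refl ← ordSum-finite b≢1 (y∉x∷xs ∘ there) s = k + c , refl
ordSum-finite {y = y} {x ∷ _} b≢1 y∉x∷xs (cons {u = ∞} o _) =
  contradiction (here (ℤ.i-j≡0⇒i≡j y x (ℤ.∣i∣≡0⇒i≡0 (ord≡∞⇒∣∣≡0 (y - x) b≢1 o)))) y∉x∷xs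

ord₀-fin⇒0 : ∀ z {k} → IsOrd 0 z (fin k) → k ≡ 0
ord₀-fin⇒0 z {zero} _ = refl
ord₀-fin⇒0 z {suc k} (0^k∣z , 0^k+1∤z) =
  contradiction (subst (_ ∣_) (sym (0∣⇒≡0 0^k∣z)) (_ ∣0)) 0^k+1∤z

ordSum₀-fin⇒0 : ∀ {y xs v c} → OrdSum 0 y xs v → v ≡ fin c → c ≡ 0
ordSum₀-fin⇒0 nil refl = refl
ordSum₀-fin⇒0 {y} (cons {y = x} {u = fin _} {w = fin _} o s) refl =
  cong₂ _+_ (ord₀-fin⇒0 (y - x) o) (ordSum₀-fin⇒0 s refl)
ordSum₀-fin⇒0 (cons {u = fin _} {w = ∞} _ _) ()
ordSum₀-fin⇒0 (cons {u = ∞} _ _) ()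

-- Residue classes modulo powers of b

module Levels (b : ℕ) where

  infix 4 _∼[_]_
  infix 5 _∼ᵇ[_]_

  record _∼[_]_ (y : ℤ) (s : ℕ) (x : ℤ) : Set where
    constructor mk∼
    field ∼⇒∣ : b ^ s ∣ ∣ y - x ∣

  open _∼[_]_

  ∼-refl : ∀ {s y} → y ∼[ s ] y
  ∼-refl {s} {y} = mk∼ (subst (b ^ s ∣_) (sym (cong ∣_∣ (ℤ.+-inverseʳ y))) (_ ∣0))

  ∼-sym : ∀ {s y x} → y ∼[ s ] x → x ∼[ s ] y
  ∼-sym {s} {y} {x} (mk∼ d) = mk∼ (subst (b ^ s ∣_) (ℤ.∣i-j∣≡∣j-i∣ y x) d)

  ∼-trans : ∀ {s x y z} → x ∼[ s ] y → y ∼[ s ] z → x ∼[ s ] z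
  ∼-trans {s} {x} {y} {z} (mk∼ d₁) (mk∼ d₂) =
    mk∼ (subst (b ^ s ∣_) (cong ∣_∣ (ℤ.+-minus-telescope x y z))
          (Signed.∣⇒∣ᵤ {bˢ} {(x - y) Int.+ (y - z)}
            (Signed.∣m∣n⇒∣m+n (Signed.∣ᵤ⇒∣ {bˢ} {x - y} d₁) (Signed.∣ᵤ⇒∣ {bˢ} {y - z} d₂))))
    where bˢ = Int.+ (b ^ s)

  ∼-weaken : ∀ {s s′ y x} → s ≤ s′ → y ∼[ s′ ] x → y ∼[ s ] x
  ∼-weaken s≤s′ (mk∼ d) = mk∼ (∣-trans (^-monoʳ-∣ b s≤s′) d)

  ∼-zero : ∀ {y x} → y ∼[ 0 ] x
  ∼-zero = mk∼ (1∣ _)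

  ∼-dec : ∀ s y x → Dec (y ∼[ s ] x)
  ∼-dec s y x = map′ mk∼ ∼⇒∣ (b ^ s ∣? ∣ y - x ∣)

  -- Opaque so that s, y and x can be inferred from y ∼ᵇ[ s ] x.
  opaque
    _∼ᵇ[_]_ : ℤ → ℕ → ℤ → Bool
    y ∼ᵇ[ s ] x = does (∼-dec s y x)

    ∼ᵇ-true : ∀ {s y x} → y ∼[ s ] x → y ∼ᵇ[ s ] x ≡ true
    ∼ᵇ-true {s} {y} {x} = dec-true (∼-dec s y x)

    ∼ᵇ-false : ∀ {s y x} → ¬ y ∼[ s ] x → y ∼ᵇ[ s ] x ≡ false
    ∼ᵇ-false {s} {y} {x} = dec-false (∼-dec s y x)

    ∼ᵇ-does : ∀ s y x → y ∼ᵇ[ s ] x ≡ does (∼-dec s y x)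
    ∼ᵇ-does s y x = refl

  ∼ᵇ⇒∼ : ∀ {s y x} → y ∼ᵇ[ s ] x ≡ true → y ∼[ s ] x
  ∼ᵇ⇒∼ {s} {y} {x} eq =
    decidable-stable (∼-dec s y x) (λ y≁x → contradiction (trans (sym eq) (∼ᵇ-false y≁x)) λ ())

  count : ℕ → ℤ → List ℤ → ℕ
  count s y = countᵇ (y ∼ᵇ[ s ]_)

  count-resp : ∀ {s y y′} → y ∼[ s ] y′ → ∀ xs → count s y xs ≡ count s y′ xs
  count-resp {s} {y} {y′} y∼y′ = countᵇ-cong λ x →
    trans (∼ᵇ-does s y x)
          (trans (does-⇔ (mk⇔ (∼-trans (∼-sym y∼y′)) (∼-trans y∼y′)) (∼-dec s y x) (∼-dec s y′ x))
                 (sym (∼ᵇ-does s y′ x)))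

  count-length : ∀ y xs → count 0 y xs ≡ length xs
  count-length y = countᵇ-all (λ x → ∼ᵇ-true ∼-zero)

  depth : ℕ → ℤ → ℤ → ℕ
  depth H y x = sumFrom (λ s → indicator (y ∼ᵇ[ s ] x)) 1 H

  -- weight 1 H y xs = Σ_{x ∈ xs} min (ord_b (y - x), H), counted level by level;
  -- weight lo c only counts the levels lo ≤ s < lo + c.
  weight : ℕ → ℕ → ℤ → List ℤ → ℕ
  weight lo c y xs = sumFrom (λ s → count s y xs) lo c

  depth≡truncate : ∀ {H y x u} → IsOrd b (y - x) u → depth H y x ≡ truncate H u
  depth≡truncate {H} {y} {x} {∞} bˢ∣ =
    trans (sumFrom-constant 1 1 H λ {s} _ _ → cong indicator (∼ᵇ-true (mk∼ {y} {s} {x} (bˢ∣ s))))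
          (*-identityʳ H)
  depth≡truncate {H} {y} {x} {fin k} (bᵏ∣ , bᵏ⁺¹∤) with ≤-total k H
  ... | inj₁ k≤H = begin
    depth H y x                                       ≡⟨ cong (sumFrom _ 1) (sym (m+[n∸m]≡n k≤H)) ⟩
    sumFrom _ 1 (k + (H ∸ k))                         ≡⟨ sumFrom-+ _ 1 k (H ∸ k) ⟩
    sumFrom _ 1 k + sumFrom _ (suc k) (H ∸ k)
      ≡⟨ cong₂ _+_ (sumFrom-constant 1 1 k below) (sumFrom-constant 0 (suc k) (H ∸ k) above) ⟩
    k * 1 + (H ∸ k) * 0                               ≡⟨ cong₂ _+_ (*-identityʳ k) (*-zeroʳ (H ∸ k)) ⟩
    k + 0                                             ≡⟨ +-identityʳ k ⟩
    k                                                 ≡⟨ m≤n⇒m⊓n≡m k≤H ⟨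
    k ⊓ H                                             ∎
    where
    open ≡-Reasoning
    below : ∀ {s} → 1 ≤ s → s < 1 + k → indicator (y ∼ᵇ[ s ] x) ≡ 1
    below _ s<1+k = cong indicator (∼ᵇ-true (∼-weaken (≤-pred s<1+k) (mk∼ {y} {k} {x} bᵏ∣)))
    above : ∀ {s} → suc k ≤ s → s < suc k + (H ∸ k) → indicator (y ∼ᵇ[ s ] x) ≡ 0
    above k<s _ = cong indicator (∼ᵇ-false (λ y∼x → bᵏ⁺¹∤ (∼⇒∣ (∼-weaken k<s y∼x))))
  ... | inj₂ H≤k =
    trans (sumFrom-constant 1 1 H below) (trans (*-identityʳ H) (sym (m≥n⇒m⊓n≡n H≤k)))
    where
    below : ∀ {s} → 1 ≤ s → s < 1 + H → indicator (y ∼ᵇ[ s ] x) ≡ 1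
    below _ s<1+H =
      cong indicator (∼ᵇ-true (∼-weaken (≤-trans (≤-pred s<1+H) H≤k) (mk∼ {y} {k} {x} bᵏ∣)))

  weight-[] : ∀ lo c y → weight lo c y [] ≡ 0
  weight-[] lo c y = trans (sumFrom-const 0 lo c) (*-zeroʳ c)

  weight-∷ : ∀ H y x xs → weight 1 H y (x ∷ xs) ≡ depth H y x + weight 1 H y xs
  weight-∷ H y x xs = sumFrom-distrib _ _ 1 H

  weight-++ : ∀ lo c y xs ys → weight lo c y (xs ++ ys) ≡ weight lo c y xs + weight lo c y ys
  weight-++ lo c y xs ys =
    trans (sumFrom-cong lo c (λ {s} _ _ → countᵇ-++ (y ∼ᵇ[ s ]_) xs ys)) (sumFrom-distrib _ _ lo c)

  weight-split : ∀ t c y xs → weight 1 (t + c) y xs ≡ weight 1 t y xs + weight (suc t) c y xs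
  weight-split t c y xs = sumFrom-+ _ 1 t c

  weight-resp : ∀ {t y y′} → y ∼[ t ] y′ → ∀ xs → weight 1 t y xs ≡ weight 1 t y′ xs
  weight-resp {t} y∼y′ xs = sumFrom-cong 1 t (λ _ s<1+t → count-resp (∼-weaken (≤-pred s<1+t) y∼y′) xs)

  weight-prefix-mono : ∀ lo c y a {i j} → i ≤ j → weight lo c y (prefix a i) ≤ weight lo c y (prefix a j)
  weight-prefix-mono lo c y a i≤j = sumFrom-mono (λ s → countᵇ-prefix-mono _ a i≤j) lo c

  weight≡ordSum : ∀ {H y xs v c} → OrdSum b y xs v → v ≡ fin c → c < H → weight 1 H y xs ≡ c
  weight≡ordSum {H} {y} nil refl _ = weight-[] 1 H y
  weight≡ordSum {H} {y} {x ∷ xs} (cons {u = fin k} {w = fin c} o s) refl k+c<H = begin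
    weight 1 H y (x ∷ xs)
      ≡⟨ weight-∷ H y x xs ⟩
    depth H y x + weight 1 H y xs
      ≡⟨ cong₂ _+_ (depth≡truncate o) (weight≡ordSum s refl (≤-<-trans (m≤n+m c k) k+c<H)) ⟩
    k ⊓ H + c
      ≡⟨ cong (_+ c) (m≤n⇒m⊓n≡m (≤-trans (m≤m+n k c) (<⇒≤ k+c<H))) ⟩
    k + c
      ∎
    where open ≡-Reasoning
  weight≡ordSum (cons {u = fin _} {w = ∞} _ _) ()
  weight≡ordSum (cons {u = ∞} _ _) ()

  ordSum≡weight : ∀ {H y xs v} → OrdSum b y xs v → weight 1 H y xs < H → v ≡ fin (weight 1 H y xs)
  ordSum≡weight {H} {y} nil _ = cong fin (sym (weight-[] 1 H y))
  ordSum≡weight {H} {y} {x ∷ xs} (cons {u = u} o s) W<H =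
    trans (cong₂ _⊕_ u≡depth (ordSum≡weight s (≤-<-trans (m≤n+m _ _) d+W<H)))
          (cong fin (sym (weight-∷ H y x xs)))
    where
    d+W<H : depth H y x + weight 1 H y xs < H
    d+W<H = subst (_< H) (weight-∷ H y x xs) W<H
    u≡depth : u ≡ fin (depth H y x)
    u≡depth = trans (truncate<⇒≡fin u (subst (_< H) (depth≡truncate o) (≤-<-trans (m≤m+n _ _) d+W<H)))
                    (cong fin (sym (depth≡truncate o)))

  Sparse : (ℕ → ℤ) → ℕ → ℕ → List ℤ → Set
  Sparse a t j xs = count t (a j) xs ≤ count t (a j) (prefix a j)

  Saturated : ℕ → (ℤ → Bool) → Set
  Saturated t p = ∀ {z z′} → p z ≡ true → z ∼[ t ] z′ → p z′ ≡ true

  removeClass : ℕ → (ℤ → Bool) → ℤ → ℤ → Bool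
  removeClass t p y z = if y ∼ᵇ[ t ] z then false else p z

  removeClass-∼ : ∀ {t y z} p → y ∼[ t ] z → removeClass t p y z ≡ false
  removeClass-∼ {z = z} p y∼z = cong (if_then false else p z) (∼ᵇ-true y∼z)

  removeClass-≁ : ∀ {t y z} p → ¬ y ∼[ t ] z → removeClass t p y z ≡ p z
  removeClass-≁ {z = z} p y≁z = cong (if_then false else p z) (∼ᵇ-false y≁z)

  removeClass-⊆ : ∀ {z} t p y → removeClass t p y z ≡ true → p z ≡ true
  removeClass-⊆ {z} t p y eq with ∼-dec t y z
  ... | yes y∼z = contradiction (trans (sym eq) (removeClass-∼ p y∼z)) λ ()
  ... | no y≁z = trans (sym (removeClass-≁ p y≁z)) eq

  removeClass-saturated : ∀ {t p} y → Saturated t p → Saturated t (removeClass t p y)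
  removeClass-saturated {t} {p} y sat {z} {z′} eq z∼z′ with ∼-dec t y z
  ... | yes y∼z = contradiction (trans (sym eq) (removeClass-∼ p y∼z)) λ ()
  ... | no y≁z = trans (removeClass-≁ p (λ y∼z′ → y≁z (∼-trans y∼z′ (∼-sym z∼z′))))
                       (sat (trans (sym (removeClass-≁ p y≁z)) eq) z∼z′)

  countᵇ-removeClass : ∀ {t p y} → Saturated t p → p y ≡ true →
                       ∀ xs → countᵇ p xs ≡ countᵇ (removeClass t p y) xs + count t y xs
  countᵇ-removeClass {t} {p} {y} sat py = countᵇ-split split
    where
    split : ∀ z → indicator (p z) ≡ indicator (removeClass t p y z) + indicator (y ∼ᵇ[ t ] z)
    split z with ∼-dec t y z
    ... | yes y∼z rewrite removeClass-∼ p y∼z | ∼ᵇ-true y∼z | sat py y∼z = refl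
    ... | no y≁z rewrite removeClass-≁ p y≁z | ∼ᵇ-false y≁z = sym (+-identityʳ _)

  -- Scan a (J − 1), a (J − 2), …: a term outside p is skipped, and a term that is not sparse has
  -- more elements of xs than earlier terms in its class, so removing that class keeps the inequality.
  sparse-in-union : ∀ a {t} J xs p → Saturated (suc t) p → countᵇ p xs < countᵇ p (prefix a J) →
                    ∃[ j ] j < J × p (a j) ≡ true × Sparse a (suc t) j xs
  sparse-in-union a (suc J) xs p sat lt with p (a J) in paJ
  ... | false =
    let j , j<J , paj , sparse = sparse-in-union a J xs p sat (subst (countᵇ p xs <_) drop lt)
    in j , m<n⇒m<1+n j<J , paj , sparse
    where
    drop : countᵇ p (prefix a (suc J)) ≡ countᵇ p (prefix a J)
    drop = trans (countᵇ-prefix-suc p a J)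
                 (trans (cong ((countᵇ p (prefix a J) +_) ∘ indicator) paJ) (+-identityʳ _))
  sparse-in-union a {t} (suc J) xs p sat lt | true
    with count (suc t) (a J) xs ≤? count (suc t) (a J) (prefix a J)
  ... | yes sparse = J , n<1+n J , paJ , sparse
  ... | no ¬sparse =
    let j , j<J , p′aj , sparse = sparse-in-union a J xs p′ (removeClass-saturated (a J) sat) lt′
    in j , m<n⇒m<1+n j<J , removeClass-⊆ (suc t) p (a J) p′aj , sparse
    where
    p′ = removeClass (suc t) p (a J)
    P = prefix a J
    cnt≤ : countᵇ p xs ≤ countᵇ p P
    cnt≤ = ≤-pred (subst (countᵇ p xs <_)
             (trans (countᵇ-prefix-suc p a J) (trans (cong ((countᵇ p P +_) ∘ indicator) paJ) (+-comm _ 1))) lt)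
    lt′ : countᵇ p′ xs < countᵇ p′ P
    lt′ = +-cancelʳ-< (count (suc t) (a J) xs) _ _ (begin-strict
      countᵇ p′ xs + count (suc t) (a J) xs   ≡⟨ countᵇ-removeClass sat paJ xs ⟨
      countᵇ p xs                            ≤⟨ cnt≤ ⟩
      countᵇ p P                             ≡⟨ countᵇ-removeClass sat paJ P ⟩
      countᵇ p′ P + count (suc t) (a J) P     <⟨ +-monoʳ-< (countᵇ p′ P) (≰⇒> ¬sparse) ⟩
      countᵇ p′ P + count (suc t) (a J) xs    ∎)
      where open ≤-Reasoning

  sparse-refines : ∀ a {t j xs} → Sparse a t j xs → ∃[ i ] i ≤ j × a i ∼[ t ] a j × Sparse a (suc t) i xs
  sparse-refines a {t} {j} {xs} sparse =
    let i , i<1+j , aj∼ai , sparse′ = sparse-in-union a (suc j) xs (a j ∼ᵇ[ t ]_) saturated lt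
    in i , ≤-pred i<1+j , ∼-sym (∼ᵇ⇒∼ aj∼ai) , sparse′
    where
    saturated : Saturated (suc t) (a j ∼ᵇ[ t ]_)
    saturated aj∼z z∼z′ = ∼ᵇ-true (∼-trans (∼ᵇ⇒∼ aj∼z) (∼-weaken (n≤1+n t) z∼z′))
    lt : count t (a j) xs < count t (a j) (prefix a (suc j))
    lt = begin-strict
      count t (a j) xs                                          ≤⟨ sparse ⟩
      count t (a j) (prefix a j)                                <⟨ m<m+n _ z<s ⟩
      count t (a j) (prefix a j) + 1
        ≡⟨ cong ((count t (a j) (prefix a j) +_) ∘ indicator) (∼ᵇ-true ∼-refl) ⟨
      count t (a j) (prefix a j) + indicator (a j ∼ᵇ[ t ] a j)  ≡⟨ countᵇ-prefix-suc _ a j ⟨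
      count t (a j) (prefix a (suc j))                          ∎
      where open ≤-Reasoning

-- b-orderings

alpha-exists : ∀ {S b a} → IsBOrdering S b a → ∀ n → Σ ℕ∞ (IsAlpha S b n)
alpha-exists {b = b} {a} ordering n =
  let v , sum = ordSum-exists b (a n) (prefix a n) in v , a , ordering , sum

module BOrdering {S : ℤ → Set} {b : ℕ} {a : ℕ → ℤ} (ordering : IsBOrdering S b a) where
  open Levels b

  ∈S : ∀ i → S (a i)
  ∈S = proj₁ ordering

  ordSum≤weight : ∀ {H i y v} → S y → OrdSum b (a i) (prefix a i) v → weight 1 H y (prefix a i) < H →
                  ∃[ c ] v ≡ fin c × c ≤ weight 1 H y (prefix a i)
  ordSum≤weight {i = zero} _ nil _ = 0 , refl , z≤n
  ordSum≤weight {H} {suc i} {y} y∈S sum W<H =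
    let w , sum-y = ordSum-exists b y (prefix a (suc i))
    in ≤∞-fin (subst (_ ≤∞_) (ordSum≡weight sum-y W<H) (proj₂ ordering (suc i) z<s _ sum y y∈S w sum-y))

  weight-minimal : ∀ {H i y} → S y → weight 1 H y (prefix a i) < H →
                   weight 1 H (a i) (prefix a i) ≤ weight 1 H y (prefix a i)
  weight-minimal {H} {i} {y} y∈S W<H =
    let v , sum = ordSum-exists b (a i) (prefix a i)
        c , v≡c , c≤W = ordSum≤weight {i = i} y∈S sum W<H
    in ≤-trans (≤-reflexive (weight≡ordSum sum v≡c (≤-<-trans c≤W W<H))) c≤W

  module _ {n N : ℕ} (sum-n : OrdSum b (a n) (prefix a n) (fin N)) where

    H : ℕ
    H = suc N

    weight-aₙ : weight 1 H (a n) (prefix a n) ≡ N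
    weight-aₙ = weight≡ordSum sum-n refl ≤-refl

    weight-bounded : ∀ {j} → j ≤ n → weight 1 H (a j) (prefix a j) ≤ N
    weight-bounded {j} j≤n = ≤-trans (weight-minimal {i = j} (∈S n) (s≤s aₙ-bound)) aₙ-bound
      where
      aₙ-bound : weight 1 H (a n) (prefix a j) ≤ N
      aₙ-bound = subst (weight 1 H (a n) (prefix a j) ≤_) weight-aₙ (weight-prefix-mono 1 H (a n) a j≤n)

    weight-minimal-earlier : ∀ {i j} → i ≤ j → j ≤ n →
                             weight 1 H (a i) (prefix a i) ≤ weight 1 H (a j) (prefix a i)
    weight-minimal-earlier {i} {j} i≤j j≤n =
      weight-minimal {i = i} (∈S j) (s≤s (≤-trans (weight-prefix-mono 1 H (a j) a i≤j) (weight-bounded j≤n)))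

    -- Below level t the classes of a i and a j coincide, so minimality at a i bounds the upper levels.
    upper-weight-mono : ∀ {t c i j} → t + c ≡ H → i ≤ j → j ≤ n → a i ∼[ t ] a j →
                        weight (suc t) c (a i) (prefix a i) ≤ weight (suc t) c (a j) (prefix a j)
    upper-weight-mono {t} {c} {i} {j} t+c≡H i≤j j≤n aᵢ∼aⱼ =
      ≤-trans (+-cancelˡ-≤ (weight 1 t (a j) Pᵢ) _ _ split≤) (weight-prefix-mono (suc t) c (a j) a i≤j)
      where
      Pᵢ = prefix a i
      split≤ : weight 1 t (a j) Pᵢ + weight (suc t) c (a i) Pᵢ ≤
               weight 1 t (a j) Pᵢ + weight (suc t) c (a j) Pᵢ
      split≤ = begin
        weight 1 t (a j) Pᵢ + weight (suc t) c (a i) Pᵢ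
          ≡⟨ cong (_+ weight (suc t) c (a i) Pᵢ) (weight-resp aᵢ∼aⱼ Pᵢ) ⟨
        weight 1 t (a i) Pᵢ + weight (suc t) c (a i) Pᵢ  ≡⟨ weight-split t c (a i) Pᵢ ⟨
        weight 1 (t + c) (a i) Pᵢ                       ≡⟨ cong (λ h → weight 1 h (a i) Pᵢ) t+c≡H ⟩
        weight 1 H (a i) Pᵢ                             ≤⟨ weight-minimal-earlier i≤j j≤n ⟩
        weight 1 H (a j) Pᵢ                             ≡⟨ cong (λ h → weight 1 h (a j) Pᵢ) t+c≡H ⟨
        weight 1 (t + c) (a j) Pᵢ                       ≡⟨ weight-split t c (a j) Pᵢ ⟩
        weight 1 t (a j) Pᵢ + weight (suc t) c (a j) Pᵢ  ∎
        where open ≤-Reasoning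

    descend : ∀ c {t j xs} → t + c ≡ H → j ≤ n → Sparse a t j xs →
              ∃[ i ] i ≤ j × a i ∼[ t ] a j × weight (suc t) c (a i) xs ≤ weight (suc t) c (a j) (prefix a j)
    descend zero {t} {j} _ _ _ = j , ≤-refl , ∼-refl , z≤n
    descend (suc c) {t} {j} {xs} t+c≡H j≤n sparse =
      let j′ , j′≤j , aⱼ′∼aⱼ , sparse′ = sparse-refines a {xs = xs} sparse
          i , i≤j′ , aᵢ∼aⱼ′ , upper≤ =
            descend c {xs = xs} (trans (sym (+-suc t c)) t+c≡H) (≤-trans j′≤j j≤n) sparse′
      in i , ≤-trans i≤j′ j′≤j , ∼-trans (∼-weaken (n≤1+n t) aᵢ∼aⱼ′) aⱼ′∼aⱼ , (begin
        count (suc t) (a i) xs + weight (2 + t) c (a i) xs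
          ≡⟨ cong (_+ weight (2 + t) c (a i) xs) (count-resp aᵢ∼aⱼ′ xs) ⟩
        count (suc t) (a j′) xs + weight (2 + t) c (a i) xs
          ≤⟨ +-mono-≤ sparse′ upper≤ ⟩
        count (suc t) (a j′) (prefix a j′) + weight (2 + t) c (a j′) (prefix a j′)
          ≤⟨ upper-weight-mono t+c≡H j′≤j j≤n aⱼ′∼aⱼ ⟩
        weight (suc t) (suc c) (a j) (prefix a j) ∎)
      where open ≤-Reasoning

    light-term : ∀ xs → length xs ≤ n → ∃[ i ] i ≤ n × weight 1 H (a i) xs ≤ N
    light-term xs |xs|≤n =
      let i , i≤n , _ , w≤ = descend H {xs = xs} refl ≤-refl sparse₀
      in i , i≤n , subst (weight 1 H (a i) xs ≤_) weight-aₙ w≤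
      where
      sparse₀ : Sparse a 0 n xs
      sparse₀ = subst₂ _≤_ (sym (count-length (a n) xs))
                           (sym (trans (count-length (a n) (prefix a n)) (length-prefix a n))) |xs|≤n

-- Superadditivity and finiteness of α

ordSums≤weight : ∀ {S b a₁ a₂ ℓ m vℓ vm H y} → IsBOrdering S b a₁ → IsBOrdering S b a₂ → S y →
                 OrdSum b (a₁ ℓ) (prefix a₁ ℓ) vℓ → OrdSum b (a₂ m) (prefix a₂ m) vm →
                 let open Levels b; X = prefix a₁ ℓ ++ prefix a₂ m in
                 weight 1 H y X < H → (vℓ ⊕ vm) ≤∞ fin (weight 1 H y X)
ordSums≤weight {b = b} {a₁} {a₂} {ℓ} {m} {H = H} {y} ordering₁ ordering₂ y∈S sumℓ summ W<H
  rewrite Levels.weight-++ b 1 H y (prefix a₁ ℓ) (prefix a₂ m)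
  with c₁ , refl , c₁≤W₁ ← BOrdering.ordSum≤weight ordering₁ {i = ℓ} y∈S sumℓ (≤-<-trans (m≤m+n _ _) W<H)
     | c₂ , refl , c₂≤W₂ ← BOrdering.ordSum≤weight ordering₂ {i = m} y∈S summ (≤-<-trans (m≤n+m _ _) W<H)
  = fin≤fin (+-mono-≤ c₁≤W₁ c₂≤W₂)

alpha-superadditive : ∀ {S b k ℓ m vk vℓ vm} → ℓ + m ≡ k →
                      IsAlpha S b k vk → IsAlpha S b ℓ vℓ → IsAlpha S b m vm → (vℓ ⊕ vm) ≤∞ vk
alpha-superadditive {vk = ∞} _ _ _ _ = _ ≤∞∞
alpha-superadditive {k = k} {ℓ} {m} {fin N} ℓ+m≡k
                    (a , ordering , sumk) (a₁ , ordering₁ , sumℓ) (a₂ , ordering₂ , summ)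
  with i , _ , W≤N ← BOrdering.light-term ordering sumk (prefix a₁ ℓ ++ prefix a₂ m)
                       (≤-reflexive (trans (length-prefix-++ a₁ a₂ ℓ m) ℓ+m≡k))
  = ≤∞-trans (ordSums≤weight ordering₁ ordering₂ (BOrdering.∈S ordering i) sumℓ summ (s≤s W≤N))
             (fin≤fin W≤N)

alpha-∣ : ∀ {S b k ℓ m vk vℓ vm} → ℓ + m ≡ k →
          IsAlpha S b k vk → IsAlpha S b ℓ vℓ → IsAlpha S b m vm → pow∞ b vℓ * pow∞ b vm ∣ pow∞ b vk
alpha-∣ {b = b} ℓ+m≡k αk αℓ αm = pow∞-⊕-∣ b (alpha-superadditive ℓ+m≡k αk αℓ αm)

alpha-trivial : ∀ {S b k ℓ m v} → ℓ + m ≡ k → IsAlpha S b ℓ v →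
                (∀ vk → IsAlpha S b k vk → pow∞ b vk ≡ 1) → pow∞ b v ≡ 1
alpha-trivial {b = b} {k} {m = m} {v} ℓ+m≡k αℓ@(_ , ordering , _) k-trivial =
  let vk , αk = alpha-exists ordering k
      vm , αm = alpha-exists ordering m
  in ∣1⇒≡1 (m*n∣⇒m∣ (pow∞ b v) (pow∞ b vm)
             (subst (_ ∣_) (k-trivial vk αk) (alpha-∣ ℓ+m≡k αk αℓ αm)))

injective-∉ : ∀ {k} (f : Fin (suc k) → ℤ) → Injective _≡_ _≡_ f →
              (xs : List ℤ) → length xs ≤ k → ∃[ i ] f i ∉ xs
injective-∉ f f-inj xs |xs|≤k with Fin.any? (λ i → ¬? (f i ∈ℤ? xs))
... | yes escape = escape
... | no ¬escape =
  let i , j , i<j , same-index = Fin.pigeonhole (s≤s |xs|≤k) (index ∘ ∈xs)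
      fᵢ≡fⱼ = trans (lookup-index (∈xs i)) (trans (cong (lookup xs) same-index) (sym (lookup-index (∈xs j))))
  in contradiction (cong toℕ (f-inj fᵢ≡fⱼ)) (<⇒≢ i<j)
  where
  ∈xs : ∀ i → f i ∈ xs
  ∈xs i = decidable-stable (f i ∈ℤ? xs) (λ fᵢ∉ → ¬escape (i , fᵢ∉))

alpha-finite : ∀ {S b n k v} → b ≢ 1 → n ≤ k → CardGt S k → IsAlpha S b n v → ∃[ c ] v ≡ fin c
alpha-finite {n = zero} _ _ _ (_ , _ , nil) = 0 , refl
alpha-finite {b = b} {suc n} {k} b≢1 n<k (f , f-inj , f∈S) (a , ordering , sum)
  with i , fᵢ∉ ← injective-∉ f f-inj (prefix a (suc n)) (subst (_≤ k) (sym (length-prefix a (suc n))) n<k)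
  with w , sumᵢ ← ordSum-exists b (f i) (prefix a (suc n))
  with c , refl ← ordSum-finite b≢1 fᵢ∉ sumᵢ
  with m , v≡m , _ ← ≤∞-fin (proj₂ ordering (suc n) z<s _ sum (f i) (f∈S i) (fin c) sumᵢ)
  = m , v≡m

alpha-pos : ∀ {S b n k v} → n ≤ k → CardGt S k → IsAlpha S b n v → 0 < pow∞ b v
alpha-pos {b = suc zero} {v = v} _ _ _ = ≤-reflexive (sym (pow∞-1 v))
alpha-pos {b = zero} n≤k card α@(_ , _ , sum) with c , refl ← alpha-finite (λ ()) n≤k card α
  rewrite ordSum₀-fin⇒0 sum refl = z<s
alpha-pos {b = suc (suc _)} n≤k card α with c , refl ← alpha-finite (λ ()) n≤k card α = m^n>0 _ c

entry : ℕ × ℕ∞ → ℕ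
entry (b , v) = pow∞ b v

factor : List (ℕ × ℕ∞) → ℕ → ℕ
factor [] b = 1
factor ((c , v) ∷ L) b with b ≟ c
... | yes _ = pow∞ c v
... | no _ = factor L b

factor-here : ∀ c v L → factor ((c , v) ∷ L) c ≡ pow∞ c v
factor-here c v L with c ≟ c
... | yes _ = refl
... | no c≢c = contradiction refl c≢c

factor-there : ∀ {b c} v L → b ≢ c → factor ((c , v) ∷ L) b ≡ factor L b
factor-there {b} {c} v L b≢c with b ≟ c
... | yes b≡c = contradiction b≡c b≢c
... | no _ = refl

factor-∉ : ∀ L {b} → b ∉ map proj₁ L → factor L b ≡ 1
factor-∉ [] _ = refl
factor-∉ ((c , v) ∷ L) {b} b∉ with b ≟ c
... | yes b≡c = contradiction (here b≡c) b∉
... | no _ = factor-∉ L (b∉ ∘ there)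

factor-∈ : ∀ L {b} → b ∈ map proj₁ L → ∃[ v ] (b , v) ∈ L × factor L b ≡ pow∞ b v
factor-∈ ((c , v) ∷ L) {b} b∈ with b ≟ c
... | yes refl = v , here refl , refl
... | no b≢c = let w , bw∈L , eq = factor-∈ L (tail b≢c b∈) in w , there bw∈L , eq

product-ones : ∀ (xs : List ℕ) → product (map (λ _ → 1) xs) ≡ 1
product-ones [] = refl
product-ones (x ∷ xs) = trans (*-identityˡ _) (product-ones xs)

product-cong : ∀ {f g : ℕ → ℕ} {xs} → (∀ {x} → x ∈ xs → f x ≡ g x) →
               product (map f xs) ≡ product (map g xs)
product-cong f≗g = cong product (map-cong-local (All.tabulate f≗g))

product-extract : ∀ {D c} {f g : ℕ → ℕ} → Unique D → c ∈ D →
                  (∀ {x} → x ∈ D → x ≢ c → f x ≡ g x) → g c ≡ 1 →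
                  product (map f D) ≡ f c * product (map g D)
product-extract {d ∷ D} {f = f} {g} (d∉D ∷ _) (here refl) f≗g gd≡1 = cong (f d *_) (begin
  product (map f D)        ≡⟨ product-cong (λ x∈D → f≗g (there x∈D) (All.lookup d∉D x∈D ∘ sym)) ⟩
  product (map g D)        ≡⟨ *-identityˡ _ ⟨
  1 * product (map g D)    ≡⟨ cong (_* product (map g D)) gd≡1 ⟨
  g d * product (map g D)  ∎)
  where open ≡-Reasoning
product-extract {d ∷ D} {c} {f} {g} (d∉D ∷ uD) (there c∈D) f≗g gc≡1 = begin
  f d * product (map f D)          ≡⟨ cong₂ _*_ (f≗g (here refl) (All.lookup d∉D c∈D))
                                                (product-extract uD c∈D (f≗g ∘ there) gc≡1) ⟩
  g d * (f c * product (map g D))  ≡⟨ *-left-comm (g d) (f c) _ ⟩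
  f c * (g d * product (map g D))  ∎
  where open ≡-Reasoning

product-reindex : ∀ L {D} → Unique (map proj₁ L) → Unique D →
                  (∀ {p} → p ∈ L → proj₁ p ∉ D → entry p ≡ 1) →
                  product (map entry L) ≡ product (map (factor L) D)
product-reindex [] {D} _ _ _ = sym (product-ones D)
product-reindex ((c , v) ∷ L) {D} (c∉L ∷ uL) uD trivial with c ∈ℕ? D
... | yes c∈D = begin
  pow∞ c v * product (map entry L)
    ≡⟨ cong (pow∞ c v *_) (product-reindex L uL uD (trivial ∘ there)) ⟩
  pow∞ c v * product (map (factor L) D)
    ≡⟨ cong (_* product (map (factor L) D)) (factor-here c v L) ⟨
  factor ((c , v) ∷ L) c * product (map (factor L) D)
    ≡⟨ product-extract uD c∈D (λ _ → factor-there v L) (factor-∉ L (λ c∈L → All.lookup c∉L c∈L refl)) ⟨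
  product (map (factor ((c , v) ∷ L)) D)
    ∎
  where open ≡-Reasoning
... | no c∉D = begin
  pow∞ c v * product (map entry L)        ≡⟨ cong (_* product (map entry L)) (trivial (here refl) c∉D) ⟩
  1 * product (map entry L)               ≡⟨ *-identityˡ _ ⟩
  product (map entry L)                   ≡⟨ product-reindex L uL uD (trivial ∘ there) ⟩
  product (map (factor L) D)
    ≡⟨ product-cong (λ x∈D → factor-there v L (λ x≡c → c∉D (subst (_∈ D) x≡c x∈D))) ⟨
  product (map (factor ((c , v) ∷ L)) D)  ∎
  where open ≡-Reasoning

product-∣ : ∀ {f g h : ℕ → ℕ} {xs} → (∀ {x} → x ∈ xs → f x * g x ∣ h x) →
            product (map f xs) * product (map g xs) ∣ product (map h xs)
product-∣ {xs = []} _ = 1∣ _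
product-∣ {f} {g} {h} {x ∷ xs} fg∣h =
  subst (_∣ h x * product (map h xs)) (sym (*-interchange (f x) (product (map f xs)) (g x) (product (map g xs))))
        (*-pres-∣ (fg∣h (here refl)) (product-∣ (fg∣h ∘ there)))

-- Generalized factorials

module _ {S : ℤ → Set} {T : ℕ → Set} where

  Entries : ℕ → List (ℕ × ℕ∞) → Set
  Entries n L = ∀ p → p ∈ L → T (proj₁ p) × IsAlpha S (proj₁ p) n (proj₂ p)

  TrivialOutside : ℕ → List (ℕ × ℕ∞) → Set
  TrivialOutside n L = ∀ b → T b → b ∉ map proj₁ L → ∀ v → IsAlpha S b n v → pow∞ b v ≡ 1

  factor-alpha : ∀ {n b} L → Entries n L → TrivialOutside n L → T b → Σ (ℕ → ℤ) (IsBOrdering S b) →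
                 ∃[ v ] IsAlpha S b n v × factor L b ≡ pow∞ b v
  factor-alpha {n} {b} L entries outside Tb (_ , ordering) with b ∈ℕ? map proj₁ L
  ... | yes b∈ = let v , bv∈L , eq = factor-∈ L b∈ in v , proj₂ (entries _ bv∈L) , eq
  ... | no b∉ =
    let v , α = alpha-exists ordering n in v , α , trans (factor-∉ L b∉) (sym (outside b Tb b∉ v α))

  entries-trivial-outside : ∀ {k ℓ m L Lk} → ℓ + m ≡ k → Entries ℓ L → TrivialOutside k Lk →
                            ∀ {p} → p ∈ L → proj₁ p ∉ map proj₁ Lk → entry p ≡ 1
  entries-trivial-outside ℓ+m≡k entries outside {c , v} p∈L c∉ =
    let Tc , α = entries _ p∈L in alpha-trivial ℓ+m≡k α (outside c Tc c∉)

  factorial-∣ : ∀ {k ℓ m nk nℓ nm} → ℓ + m ≡ k →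
                IsFactorial S T k nk → IsFactorial S T ℓ nℓ → IsFactorial S T m nm → nℓ * nm ∣ nk
  factorial-∣ {ℓ = ℓ} {m} ℓ+m≡k
              (Lk , uk , ek , nk≡ , ok) (Lℓ , uℓ , eℓ , nℓ≡ , oℓ) (Lm , um , em , nm≡ , om) =
    subst₂ _∣_
      (sym (cong₂ _*_ (trans nℓ≡ (product-reindex Lℓ uℓ uk (entries-trivial-outside ℓ+m≡k eℓ ok)))
                      (trans nm≡ (product-reindex Lm um uk
                                   (entries-trivial-outside (trans (+-comm m ℓ) ℓ+m≡k) em ok)))))
      (sym (trans nk≡ (product-reindex Lk uk uk (λ p∈ p∉ → contradiction (∈-map⁺ proj₁ p∈) p∉))))
      (product-∣ factors-∣)
    where
    factors-∣ : ∀ {b} → b ∈ map proj₁ Lk → factor Lℓ b * factor Lm b ∣ factor Lk b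
    factors-∣ b∈ =
      let vk , bvk∈ , fk≡ = factor-∈ Lk b∈
          Tb , αk = ek _ bvk∈
          ordering = proj₁ αk , proj₁ (proj₂ αk)
          vℓ , αℓ , fℓ≡ = factor-alpha Lℓ eℓ oℓ Tb ordering
          vm , αm , fm≡ = factor-alpha Lm em om Tb ordering
      in subst₂ _∣_ (sym (cong₂ _*_ fℓ≡ fm≡)) (sym fk≡) (alpha-∣ ℓ+m≡k αk αℓ αm)

  factorial-pos : ∀ {n k x} → n ≤ k → CardGt S k → IsFactorial S T n x → 0 < x
  factorial-pos n≤k card (L , _ , entries , x≡ , _) =
    subst (0 <_) (sym x≡) (>-nonZero⁻¹ _ {{product≢0 (All.map⁺ (All.tabulate entry≢0))}})
    where
    entry≢0 : ∀ {p} → p ∈ L → NonZero (entry p)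
    entry≢0 {p} p∈L = >-nonZero (alpha-pos n≤k card (proj₂ (entries p p∈L)))

-- The hypothesis that S is nonempty is implied by CardGt S k.
theorem3p14 : (S : ℤ → Set) (T : ℕ → Set) → Σ ℤ S →
    (k ℓ : ℕ) → ℓ ≤ k → CardGt S k →
    (nk nℓ nkℓ : ℕ) →
    IsFactorial S T k nk → IsFactorial S T ℓ nℓ → IsFactorial S T (k ∸ ℓ) nkℓ →
    0 < nℓ × 0 < nkℓ × Σ ℕ (λ q → 0 < q × nk ≡ q * (nℓ * nkℓ))
theorem3p14 S T _ k ℓ ℓ≤k card nk nℓ nkℓ fk fℓ fkℓ =
  factorial-pos ℓ≤k card fℓ ,
  factorial-pos (m∸n≤m k ℓ) card fkℓ ,
  ∣⇒pos-quotient (factorial-pos ≤-refl card fk) (factorial-∣ (m+[n∸m]≡n ℓ≤k) fk fℓ fkℓ)
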